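{- Let $M$ be a normal $d$-pseudomanifold and let $A$ be an open subset of $M$. (1) A subset $S$ of $A$ is a connected component of $A$ if and only if $S$ is a strong connected component of $A$. (2) Let $B$ be an open subset of $M$ with $A \subseteq B$. Then $B$ is an extension of $A$ if and only if each strong connected component of $B$ includes exactly one strong connected component of $A$.
   Context: A simplex is a non-empty finite set; its dimension is its cardinality minus one (a $p$-simplex has dimension $p$). A (simplicial) complex is a finite set $X$ of simplexes such that every non-empty subset of an element of $X$ belongs to $X$; its elements are its faces, and a facet of a set $S$ of simplexes is an element of $S$ maximal for inclusion in $S$. A subset $S\subseteq X$ is open for $X$ (an open subset of $X$) if $x\in S$, $y\in X$, $x\subseteq y$ imply $y\in S$. A path in a finite set $S$ of simplexes is a sequence $\langle x_0,\dots,x_k\rangle$ of elements of $S$ such that for each $i\in[0,k-1]$ either $x_i\subseteq x_{i+1}$ or $x_{i+1}\subseteq x_i$; $S$ is connected if any two elements of $S$ are joined by a path in $S$; a connected component of $S$ is a maximal connected subset. A $p$-pair of $X$ is a pair $(x,y)$ of faces with $x\subseteq y$, $\dim y=p$, $\dim x=p-1$. A set $S$ of simplexes is $d$-pure if all its facets have dimension $d$. A strong $p$-path in $S$ is a path $\langle x_0,\dots,x_k\rangle$ in $S$ such that for each $i$, $(x_i,x_{i+1})$ or $(x_{i+1},x_i)$ is a $p$-pair. If $S$ is $d$-pure, $S$ is strongly connected if any two facets of $S$ are joined by a strong $d$-path in $S$; a strong connected component of $S$ is a subset of $S$ that is strongly connected and maximal for inclusion with this property. A normal $d$-pseudomanifold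 ($d\ge 1$) is a connected $d$-pure complex $M$ such that (i) each $(d-1)$-face of $M$ is contained in exactly two $d$-faces of $M$, and (ii) every connected open subset of $M$ is strongly connected. For open subsets $A\subseteq B$ of a complex $X$: if $A\neq\emptyset$, $B$ is an extension of $A$ if each connected component of $B$ includes exactly one connected component of $A$; if $A=\emptyset$, $B$ is an extension of $A$ iff $B=\emptyset$. -}

module Defs where

open import Data.Nat using (ℕ; suc)
open import Data.Bool using (Bool; true)
open import Data.Fin.Subset using (Subset; _⊆_; ∣_∣; Nonempty)
open import Data.Product using (Σ; ∃; _×_)
open import Data.Sum using (_⊎_)
open import Relation.Binary.PropositionalEquality using (_≡_; _≢_)
open import Relation.Nullary using (¬_)

-- Vertices are the elements of Fin n; a candidate simplex is a Subset n
-- (simplex = non-empty subset).  A (finite) set of simplexes is a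
-- Bool-valued (hence decidable) predicate on Subset n.
SSet : ℕ → Set
SSet n = Subset n → Bool

module _ {n : ℕ} where

  infix 4 _∈ₛ_ _⊆ₛ_ _≐_

  _∈ₛ_ : Subset n → SSet n → Set
  x ∈ₛ S = S x ≡ true

  _⊆ₛ_ : SSet n → SSet n → Set
  S ⊆ₛ T = ∀ x → x ∈ₛ S → x ∈ₛ T

  _≐_ : SSet n → SSet n → Set
  S ≐ T = (S ⊆ₛ T) × (T ⊆ₛ S)

  NonemptyS : SSet n → Set
  NonemptyS S = ∃ λ x → x ∈ₛ S

  EmptyS : SSet n → Set
  EmptyS S = ∀ x → ¬ (x ∈ₛ S)

  -- dim x = p  is expressed as  ∣ x ∣ ≡ suc p
  IsComplex : SSet n → Set
  IsComplex X = (∀ x → x ∈ₛ X → Nonempty x)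
              × (∀ x y → y ∈ₛ X → x ⊆ y → Nonempty x → x ∈ₛ X)

  Open : SSet n → SSet n → Set
  Open S X = (S ⊆ₛ X) × (∀ x y → x ∈ₛ S → y ∈ₛ X → x ⊆ y → y ∈ₛ S)

  data Path (S : SSet n) : Subset n → Subset n → Set where
    here : ∀ {x} → x ∈ₛ S → Path S x x
    step : ∀ {x y z} → x ∈ₛ S → (x ⊆ y ⊎ y ⊆ x) → Path S y z → Path S x z

  Connected : SSet n → Set
  Connected S = ∀ x y → x ∈ₛ S → y ∈ₛ S → Path S x y

  ConnectedComponent : SSet n → SSet n → Set
  ConnectedComponent S T =
    (T ⊆ₛ S) × NonemptyS T × Connected T
    × (∀ U → T ⊆ₛ U → U ⊆ₛ S → Connected U → U ⊆ₛ T)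

  Facet : SSet n → Subset n → Set
  Facet S x = x ∈ₛ S × (∀ y → y ∈ₛ S → x ⊆ y → y ⊆ x)

  Pure : ℕ → SSet n → Set
  Pure d S = ∀ x → Facet S x → ∣ x ∣ ≡ suc d

  PPair : ℕ → Subset n → Subset n → Set
  PPair p x y = (x ⊆ y) × (∣ y ∣ ≡ suc p) × (∣ x ∣ ≡ p)

  data StrongPath (p : ℕ) (S : SSet n) : Subset n → Subset n → Set where
    here : ∀ {x} → x ∈ₛ S → StrongPath p S x x
    step : ∀ {x y z} → x ∈ₛ S → (PPair p x y ⊎ PPair p y x)
         → StrongPath p S y z → StrongPath p S x z

  StronglyConnected : ℕ → SSet n → Set
  StronglyConnected d S =
    Pure d S × (∀ x y → Facet S x → Facet S y → StrongPath d S x y)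

  StrongComponent : ℕ → SSet n → SSet n → Set
  StrongComponent d S T =
    (T ⊆ₛ S) × NonemptyS T × StronglyConnected d T
    × (∀ U → T ⊆ₛ U → U ⊆ₛ S → StronglyConnected d U → U ⊆ₛ T)

  ExactlyOne : (SSet n → Set) → Set
  ExactlyOne P = Σ (SSet n) λ K → P K × (∀ K′ → P K′ → K′ ≐ K)

  NormalPseudomanifold : ℕ → SSet n → Set
  NormalPseudomanifold d M =
    IsComplex M × Connected M × Pure d M
    × (∀ x → x ∈ₛ M → ∣ x ∣ ≡ d →
         Σ (Subset n) λ y₁ → Σ (Subset n) λ y₂ →
           (y₁ ≢ y₂)
           × (y₁ ∈ₛ M × x ⊆ y₁ × ∣ y₁ ∣ ≡ suc d)
           × (y₂ ∈ₛ M × x ⊆ y₂ × ∣ y₂ ∣ ≡ suc d)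
           × (∀ y → y ∈ₛ M → x ⊆ y → ∣ y ∣ ≡ suc d → (y ≡ y₁ ⊎ y ≡ y₂)))
    × (∀ S → Open S M → Connected S → StronglyConnected d S)

  Extension : SSet n → SSet n → Set
  Extension A B =
    (NonemptyS A → ∀ C → ConnectedComponent B C →
        ExactlyOne (λ K → ConnectedComponent A K × K ⊆ₛ C))
    × (EmptyS A → EmptyS B)

-- Only condition (ii) of a normal pseudomanifold is needed.  A connected
-- component S of an open set A is itself open: the upward closure of S in M
-- is a connected subset of A containing S, so by maximality it equals S.
-- Hence S is strongly connected, and it is maximal among strongly connected
-- subsets of A because strongly connected sets are connected.  Conversely, a
-- strong component S is connected, and any connected U ⊆ A containing S has
-- an open connected, hence strongly connected, upward closure inside A, which
-- maximality of S forces back into S.  So connected and strong components of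
-- open sets coincide, and part (2) is a rewording of the definition of an
-- extension, except for the case A = ∅, which uses that every non-empty set
-- of simplexes has a connected component: the set of simplexes reachable from
-- a given one, computed as an ascending chain that stabilises by finiteness.

module Submission where

open import Defs
open import Data.Bool using (Bool; true; false; if_then_else_)
import Data.Bool as Bool
open import Data.Empty using (⊥-elim)
open import Data.Fin.Subset using (Subset; _⊆_; _⊃_; inside; outside)
open import Data.Fin.Subset.Induction using (⊃-wellFounded)
open import Data.Fin.Subset.Properties using (anySubset?; _⊆?_; _⊂?_; _∈?_; ⊆-refl; ⊆-trans)
open import Data.Nat using (ℕ; zero; suc; _+_; _≤_; _<_; z≤n; s≤s)
open import Data.Nat.Properties using (≤-refl; ≤-trans; n≮n; +-mono-≤; +-mono-<-≤; +-mono-≤-<)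
open import Data.Product using (∃; _×_; _,_; proj₁; proj₂)
open import Data.Product.Function.NonDependent.Propositional using (_×-⇔_)
open import Data.Sum using (_⊎_; inj₁; inj₂; swap; [_,_]′)
open import Data.Vec using ([]; _∷_)
open import Data.Vec.Properties using (≡-dec)
open import Function.Base using (id)
open import Function.Bundles using (_⇔_; mk⇔; Equivalence)
open import Function.Construct.Identity using (⇔-id)
open import Induction.WellFounded using (Acc; acc)
open import Relation.Binary.PropositionalEquality using (_≡_; refl)
open import Relation.Nullary using (¬_; Dec; yes; no; does; _×-dec_; _⊎-dec_; ¬?; contradiction)
open import Relation.Nullary.Decidable using (dec-true; decidable-stable)
open import Relation.Unary using (Decidable)

module _ {n : ℕ} where

  _∈ₛ?_ : ∀ x (S : SSet n) → Dec (x ∈ₛ S)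
  x ∈ₛ? S = S x Bool.≟ true

  fromDec : {P : Subset n → Set} → Decidable P → SSet n
  fromDec P? x = does (P? x)

  ∈-fromDec⁺ : ∀ {P : Subset n → Set} (P? : Decidable P) {x} → P x → x ∈ₛ fromDec P?
  ∈-fromDec⁺ P? {x} = dec-true (P? x)

  ∈-fromDec⁻ : ∀ {P : Subset n → Set} (P? : Decidable P) {x} → x ∈ₛ fromDec P? → P x
  ∈-fromDec⁻ P? {x} x∈ with P? x
  ... | yes p = p
  ... | no _ with () ← x∈

  ⊆ₛ⊎⊈ₛ : (S T : SSet n) → S ⊆ₛ T ⊎ ∃ λ y → y ∈ₛ S × ¬ y ∈ₛ T
  ⊆ₛ⊎⊈ₛ S T with anySubset? (λ y → (y ∈ₛ? S) ×-dec ¬? (y ∈ₛ? T))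
  ... | yes counterexample = inj₂ counterexample
  ... | no none = inj₁ λ y yS → decidable-stable (y ∈ₛ? T) λ y∉T → none (y , yS , y∉T)

  Adjacent : Subset n → Subset n → Set
  Adjacent x y = x ⊆ y ⊎ y ⊆ x

  adjacent? : ∀ x y → Dec (Adjacent x y)
  adjacent? x y = (x ⊆? y) ⊎-dec (y ⊆? x)

  path-source : ∀ {S : SSet n} {x y} → Path S x y → x ∈ₛ S
  path-source (here xS)     = xS
  path-source (step xS _ _) = xS

  path-mono : ∀ {S T : SSet n} {x y} → S ⊆ₛ T → Path S x y → Path T x y
  path-mono S⊆T (here xS)       = here (S⊆T _ xS)
  path-mono S⊆T (step xS adj p) = step (S⊆T _ xS) adj (path-mono S⊆T p)

  path-++ : ∀ {S : SSet n} {x y z} → Path S x y → Path S y z → Path S x z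
  path-++ (here _)        q = q
  path-++ (step xS adj p) q = step xS adj (path-++ p q)

  path-target : ∀ {S : SSet n} {x y} → Path S x y → y ∈ₛ S
  path-target (here yS)    = yS
  path-target (step _ _ p) = path-target p

  path-snoc : ∀ {S : SSet n} {x y z} → Path S x y → Adjacent y z → z ∈ₛ S → Path S x z
  path-snoc p adj zS = path-++ p (step (path-target p) adj (here zS))

  path-reverse : ∀ {S : SSet n} {x y} → Path S x y → Path S y x
  path-reverse (here xS)       = here xS
  path-reverse (step xS adj p) = path-snoc (path-reverse p) (swap adj) xS

  strongPath⇒path : ∀ {p} {S : SSet n} {x y} → StrongPath p S x y → Path S x y
  strongPath⇒path (here xS)               = here xS
  strongPath⇒path (step xS (inj₁ pair) p) = step xS (inj₁ (proj₁ pair)) (strongPath⇒path p)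
  strongPath⇒path (step xS (inj₂ pair) p) = step xS (inj₂ (proj₁ pair)) (strongPath⇒path p)

  facet-above : ∀ {U : SSet n} {x} → x ∈ₛ U → ∃ λ f → Facet U f × x ⊆ f
  facet-above {U} {x} = go (⊃-wellFounded x)
    where
    go : ∀ {x} → Acc _⊃_ x → x ∈ₛ U → ∃ λ f → Facet U f × x ⊆ f
    go {x} (acc above) xU with anySubset? (λ y → (y ∈ₛ? U) ×-dec (x ⊂? y))
    ... | yes (y , yU , x⊂y) =
      let f , f-facet , y⊆f = go (above x⊂y) yU in f , f-facet , ⊆-trans (proj₁ x⊂y) y⊆f
    ... | no none = x , (xU , maximal) , ⊆-refl
      where
      maximal : ∀ y → y ∈ₛ U → x ⊆ y → y ⊆ x
      maximal y yU x⊆y {i} i∈y with i ∈? x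
      ... | yes i∈x = i∈x
      ... | no i∉x = ⊥-elim (none (y , yU , x⊆y , i , i∈y , i∉x))

  stronglyConnected⇒connected : ∀ {d} {U : SSet n} → StronglyConnected d U → Connected U
  stronglyConnected⇒connected (_ , strong) x y xU yU =
    let fx , fx-facet , x⊆fx = facet-above xU
        fy , fy-facet , y⊆fy = facet-above yU
    in step xU (inj₁ x⊆fx)
         (path-++ (strongPath⇒path (strong fx fy fx-facet fy-facet))
                  (step (proj₁ fy-facet) (inj₂ y⊆fy) (here yU)))

  InUpClosure : SSet n → SSet n → Subset n → Set
  InUpClosure M U y = y ∈ₛ M × ∃ λ x → x ∈ₛ U × x ⊆ y

  inUpClosure? : ∀ M U → Decidable (InUpClosure M U)
  inUpClosure? M U y = (y ∈ₛ? M) ×-dec anySubset? (λ x → (x ∈ₛ? U) ×-dec (x ⊆? y))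

  upClosure : SSet n → SSet n → SSet n
  upClosure M U = fromDec (inUpClosure? M U)

  module _ {M U : SSet n} where

    ∈-upClosure⁺ : ∀ {x y} → y ∈ₛ M → x ∈ₛ U → x ⊆ y → y ∈ₛ upClosure M U
    ∈-upClosure⁺ yM xU x⊆y = ∈-fromDec⁺ (inUpClosure? M U) (yM , _ , xU , x⊆y)

    ∈-upClosure⁻ : ∀ {y} → y ∈ₛ upClosure M U → InUpClosure M U y
    ∈-upClosure⁻ = ∈-fromDec⁻ (inUpClosure? M U)

    ⊆-upClosure : U ⊆ₛ M → U ⊆ₛ upClosure M U
    ⊆-upClosure U⊆M x xU = ∈-upClosure⁺ (U⊆M x xU) xU ⊆-refl

    upClosure-open : Open (upClosure M U) M
    upClosure-open = (λ y y∈ → proj₁ (∈-upClosure⁻ y∈))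
                   , λ y z y∈ zM y⊆z → let _ , x , xU , x⊆y = ∈-upClosure⁻ y∈
                                       in ∈-upClosure⁺ zM xU (⊆-trans x⊆y y⊆z)

    upClosure-⊆-open : ∀ {A} → Open A M → U ⊆ₛ A → upClosure M U ⊆ₛ A
    upClosure-⊆-open (_ , A-up) U⊆A y y∈ =
      let yM , x , xU , x⊆y = ∈-upClosure⁻ y∈ in A-up x y (U⊆A x xU) yM x⊆y

    upClosure-connected : U ⊆ₛ M → Connected U → Connected (upClosure M U)
    upClosure-connected U⊆M U-conn y z y∈ z∈ =
      let _ , a , aU , a⊆y = ∈-upClosure⁻ y∈
          _ , b , bU , b⊆z = ∈-upClosure⁻ z∈
      in step y∈ (inj₂ a⊆y)
           (path-++ (path-mono (⊆-upClosure U⊆M) (U-conn a b aU bU))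
                    (step (⊆-upClosure U⊆M b bU) (inj₁ b⊆z) (here z∈)))

  component-open : ∀ {M A S : SSet n} → Open A M → ConnectedComponent A S → Open S M
  component-open {M} {S = S} openA@(A⊆M , _) (S⊆A , _ , S-conn , S-max) = S⊆M , S-up
    where
    S⊆M : S ⊆ₛ M
    S⊆M x xS = A⊆M x (S⊆A x xS)

    S-up : ∀ x y → x ∈ₛ S → y ∈ₛ M → x ⊆ y → y ∈ₛ S
    S-up x y xS yM x⊆y =
      S-max (upClosure M S) (⊆-upClosure S⊆M) (upClosure-⊆-open openA S⊆A)
            (upClosure-connected S⊆M S-conn) y (∈-upClosure⁺ {M} yM xS x⊆y)

  ConnectedOpenSetsStronglyConnected : ℕ → SSet n → Set
  ConnectedOpenSetsStronglyConnected d M = ∀ S → Open S M → Connected S → StronglyConnected d S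

  component⇔strongComponent : ∀ {d} {M A S : SSet n} → ConnectedOpenSetsStronglyConnected d M
    → Open A M → ConnectedComponent A S ⇔ StrongComponent d A S
  component⇔strongComponent {d} {M} {A} {S} strong openA@(A⊆M , _) = mk⇔ to from
    where
    to : ConnectedComponent A S → StrongComponent d A S
    to component@(S⊆A , S-nonempty , S-conn , S-max) =
        S⊆A , S-nonempty , strong S (component-open openA component) S-conn
      , λ U S⊆U U⊆A U-strong → S-max U S⊆U U⊆A (stronglyConnected⇒connected U-strong)

    from : StrongComponent d A S → ConnectedComponent A S
    from (S⊆A , S-nonempty , S-strong , S-max) =
      S⊆A , S-nonempty , stronglyConnected⇒connected S-strong , maximal
      where
      maximal : ∀ U → S ⊆ₛ U → U ⊆ₛ A → Connected U → U ⊆ₛ S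
      maximal U S⊆U U⊆A U-conn y yU =
        S-max (upClosure M U) (λ x xS → ⊆-upClosure U⊆M x (S⊆U x xS))
              (upClosure-⊆-open openA U⊆A)
              (strong _ upClosure-open (upClosure-connected U⊆M U-conn))
              y (⊆-upClosure U⊆M y yU)
        where
        U⊆M : U ⊆ₛ M
        U⊆M x xU = A⊆M x (U⊆A x xU)

indicator : Bool → ℕ
indicator b = if b then 1 else 0

indicator-mono : ∀ {a b} → (a ≡ true → b ≡ true) → indicator a ≤ indicator b
indicator-mono {false}        _   = z≤n
indicator-mono {true} {true}  _   = ≤-refl
indicator-mono {true} {false} a⇒b with () ← a⇒b refl

indicator-strict : ∀ {a b} → ¬ a ≡ true → b ≡ true → indicator a < indicator b
indicator-strict {false} _  refl = s≤s z≤n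
indicator-strict {true}  ¬a _    = contradiction refl ¬a

size : ∀ {n} → SSet n → ℕ
size {zero}  S = indicator (S [])
size {suc n} S = size (λ x → S (inside ∷ x)) + size (λ x → S (outside ∷ x))

size-mono : ∀ {n} {S T : SSet n} → S ⊆ₛ T → size S ≤ size T
size-mono {zero}  S⊆T = indicator-mono (S⊆T [])
size-mono {suc n} S⊆T =
  +-mono-≤ (size-mono (λ x → S⊆T (inside ∷ x))) (size-mono (λ x → S⊆T (outside ∷ x)))

size-strict : ∀ {n} {S T : SSet n} {y} → S ⊆ₛ T → ¬ y ∈ₛ S → y ∈ₛ T → size S < size T
size-strict {zero} {y = []} _ y∉S yT = indicator-strict y∉S yT
size-strict {suc n} {y = inside ∷ y} S⊆T y∉S yT =
  +-mono-<-≤ (size-strict (λ x → S⊆T (inside ∷ x)) y∉S yT) (size-mono (λ x → S⊆T (outside ∷ x)))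
size-strict {suc n} {y = outside ∷ y} S⊆T y∉S yT =
  +-mono-≤-< (size-mono (λ x → S⊆T (inside ∷ x))) (size-strict (λ x → S⊆T (outside ∷ x)) y∉S yT)

ascendingChain-stabilises : ∀ {n} (R : ℕ → SSet n) → (∀ k → R k ⊆ₛ R (suc k))
  → ∃ λ k → R (suc k) ⊆ₛ R k
ascendingChain-stabilises {n} R ascending =
  [ id , (λ large → contradiction (≤-trans large (size-mono {n} (λ _ _ → refl))) (n≮n _)) ]′
    (stable-or-large (suc (size full)))
  where
  full : SSet n
  full _ = true

  stable-or-large : ∀ k → (∃ λ j → R (suc j) ⊆ₛ R j) ⊎ k ≤ size (R k)
  stable-or-large zero = inj₂ z≤n
  stable-or-large (suc k) with stable-or-large k
  ... | inj₁ stable = inj₁ stable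
  ... | inj₂ k≤size with ⊆ₛ⊎⊈ₛ (R (suc k)) (R k)
  ...   | inj₁ stable = inj₁ (k , stable)
  ...   | inj₂ (y , y∈R′ , y∉R) = inj₂ (≤-trans (s≤s k≤size) (size-strict (ascending k) y∉R y∈R′))

module _ {n : ℕ} (B : SSet n) where

  closed-connected⇒component : ∀ {C} → C ⊆ₛ B → NonemptyS C → Connected C
    → (∀ {y z} → y ∈ₛ C → z ∈ₛ B → Adjacent y z → z ∈ₛ C) → ConnectedComponent B C
  closed-connected⇒component {C} C⊆B C-nonempty@(c , cC) C-conn closed =
    C⊆B , C-nonempty , C-conn , maximal
    where
    maximal : ∀ U → C ⊆ₛ U → U ⊆ₛ B → Connected U → U ⊆ₛ C
    maximal U C⊆U U⊆B U-conn u uU = walk (U-conn c u (C⊆U c cC) uU) cC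
      where
      walk : ∀ {x y} → Path U x y → x ∈ₛ C → y ∈ₛ C
      walk (here _)       xC = xC
      walk (step _ adj p) xC = walk p (closed xC (U⊆B _ (path-source p)) adj)

  GrowsFrom : SSet n → Subset n → Set
  GrowsFrom S y = y ∈ₛ S ⊎ y ∈ₛ B × ∃ λ z → z ∈ₛ S × Adjacent z y

  growsFrom? : ∀ S → Decidable (GrowsFrom S)
  growsFrom? S y =
    (y ∈ₛ? S) ⊎-dec ((y ∈ₛ? B) ×-dec anySubset? (λ z → (z ∈ₛ? S) ×-dec adjacent? z y))

  grow : SSet n → SSet n
  grow S = fromDec (growsFrom? S)

  ⊆-grow : ∀ S → S ⊆ₛ grow S
  ⊆-grow S y yS = ∈-fromDec⁺ (growsFrom? S) (inj₁ yS)

  reach : Subset n → ℕ → SSet n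
  reach x zero    = fromDec (≡-dec Bool._≟_ x)
  reach x (suc k) = grow (reach x k)

  reach-⊆ : ∀ {x} → x ∈ₛ B → ∀ k → reach x k ⊆ₛ B
  reach-⊆ {x} xB zero y y∈ with refl ← ∈-fromDec⁻ (≡-dec Bool._≟_ x) y∈ = xB
  reach-⊆ {x} xB (suc k) y y∈ with ∈-fromDec⁻ (growsFrom? (reach x k)) y∈
  ... | inj₁ y∈R      = reach-⊆ xB k y y∈R
  ... | inj₂ (yB , _) = yB

  ∈-reach : ∀ x k → x ∈ₛ reach x k
  ∈-reach x zero    = ∈-fromDec⁺ (≡-dec Bool._≟_ x) refl
  ∈-reach x (suc k) = ⊆-grow _ x (∈-reach x k)

  reach-path : ∀ {x} k {y} → y ∈ₛ reach x k → Path (reach x k) x y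
  reach-path {x} zero y∈ with refl ← ∈-fromDec⁻ (≡-dec Bool._≟_ x) y∈ = here y∈
  reach-path {x} (suc k) y∈ with ∈-fromDec⁻ (growsFrom? (reach x k)) y∈
  ... | inj₁ y∈R = path-mono (⊆-grow _) (reach-path k y∈R)
  ... | inj₂ (_ , z , z∈R , adj) = path-snoc (path-mono (⊆-grow _) (reach-path k z∈R)) adj y∈

  component-exists : ∀ {x} → x ∈ₛ B → ∃ λ C → ConnectedComponent B C × x ∈ₛ C
  component-exists {x} xB with ascendingChain-stabilises (reach x) (λ k → ⊆-grow (reach x k))
  ... | k , stable =
    reach x k , closed-connected⇒component (reach-⊆ xB k) (x , ∈-reach x k) connected closed
              , ∈-reach x k
    where
    connected : Connected (reach x k)
    connected y z y∈ z∈ = path-++ (path-reverse (reach-path k y∈)) (reach-path k z∈)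

    closed : ∀ {y z} → y ∈ₛ reach x k → z ∈ₛ B → Adjacent y z → z ∈ₛ reach x k
    closed {y} {z} y∈ zB adj =
      stable z (∈-fromDec⁺ (growsFrom? (reach x k)) (inj₂ (zB , y , y∈ , adj)))

ExactlyOne-map : ∀ {n} {P Q : SSet n → Set}
  → (∀ K → P K → Q K) → (∀ K → Q K → P K) → ExactlyOne P → ExactlyOne Q
ExactlyOne-map P⇒Q Q⇒P (K , pK , unique) = K , P⇒Q K pK , λ K′ qK′ → unique K′ (Q⇒P K′ qK′)

ExactlyOne-cong : ∀ {n} {P Q : SSet n → Set} → (∀ K → P K ⇔ Q K) → ExactlyOne P ⇔ ExactlyOne Q
ExactlyOne-cong {P = P} {Q} P⇔Q = mk⇔ (ExactlyOne-map to from) (ExactlyOne-map from to)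
  where
  to : ∀ K → P K → Q K
  to K = Equivalence.to (P⇔Q K)

  from : ∀ K → Q K → P K
  from K = Equivalence.from (P⇔Q K)

extension⇔ : ∀ {n} {d} {A B : SSet n}
  → (∀ K → ConnectedComponent A K ⇔ StrongComponent d A K)
  → (∀ C → ConnectedComponent B C ⇔ StrongComponent d B C)
  → Extension A B ⇔ (∀ C → StrongComponent d B C
                       → ExactlyOne (λ K → StrongComponent d A K × K ⊆ₛ C))
extension⇔ {d = d} {A} {B} componentsA componentsB = mk⇔ to from
  where
  unique⇔ : ∀ C → ExactlyOne (λ K → ConnectedComponent A K × K ⊆ₛ C)
                ⇔ ExactlyOne (λ K → StrongComponent d A K × K ⊆ₛ C)
  unique⇔ C = ExactlyOne-cong (λ K → componentsA K ×-⇔ ⇔-id _)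

  to : Extension A B → ∀ C → StrongComponent d B C
     → ExactlyOne (λ K → StrongComponent d A K × K ⊆ₛ C)
  to (unique , empty) C C-strong@(C⊆B , (x , xC) , _) with anySubset? (_∈ₛ? A)
  ... | yes A-nonempty =
    Equivalence.to (unique⇔ C) (unique A-nonempty C (Equivalence.from (componentsB C) C-strong))
  ... | no ¬A-nonempty = ⊥-elim (empty (λ y yA → ¬A-nonempty (y , yA)) x (C⊆B x xC))

  from : (∀ C → StrongComponent d B C → ExactlyOne (λ K → StrongComponent d A K × K ⊆ₛ C))
       → Extension A B
  from unique = (λ _ C C-component → Equivalence.from (unique⇔ C)
                   (unique C (Equivalence.to (componentsB C) C-component)))
              , empty
    where
    empty : EmptyS A → EmptyS B
    empty A-empty x xB =
      let C , C-component , _ = component-exists B xB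
          K , ((K⊆A , (k , kK) , _) , _) , _ = unique C (Equivalence.to (componentsB C) C-component)
      in A-empty k (K⊆A k kK)

proposition1 : ∀ {n : ℕ} (d : ℕ) → 1 ≤ d → (M : SSet n) → NormalPseudomanifold d M
    → (A : SSet n) → Open A M
    → (∀ S → S ⊆ₛ A → (ConnectedComponent A S ⇔ StrongComponent d A S))
      × (∀ B → Open B M → A ⊆ₛ B
           → (Extension A B ⇔ (∀ C → StrongComponent d B C
                 → ExactlyOne (λ K → StrongComponent d A K × K ⊆ₛ C))))
proposition1 d _ M (_ , _ , _ , _ , strong) A openA =
    (λ S _ → components openA)
  , λ B openB _ → extension⇔ (λ K → components openA) (λ C → components openB)
  where
  components : ∀ {X S} → Open X M → ConnectedComponent X S ⇔ StrongComponent d X S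
  components = component⇔strongComponent strong
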